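{- Let $G$ be a graph for which there exists a vertex $v$ such that $G\setminus v$ is acyclic. Then $\Gamma(G)$ is abelian.
   Context: Graphs are finite, multiple edges allowed (two parallel edges form a cycle), no loops; $E(v)$ is the set of edges incident to $v$; $G\setminus v$ is $G$ with $v$ and its incident edges removed. $\Gamma(G)$ is the group generated by $\{x_e:e\in E(G)\}$ with relations $x_e^2=1$ for all $e$, $[x_e,x_{e'}]=1$ whenever $e,e'\in E(w)$ for some vertex $w$, and $\prod_{e\in E(w)}x_e=1$ for each vertex $w$. -}

module Defs where

open import Data.Nat using (ℕ; _≥_)
import Data.Nat.DivMod
import Data.Fin
open import Data.Fin using (Fin; zero; suc; _≟_)
open import Data.Fin.Properties using () renaming (_≟_ to _≟F_)
open import Data.Bool using (Bool; true; false; not)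
open import Data.List using (List; []; _∷_; _++_; filter; map; allFin)
open import Data.Product using (Σ; _×_; _,_; proj₁; proj₂)
open import Data.Sum using (_⊎_)
open import Relation.Binary.PropositionalEquality using (_≡_; _≢_)
open import Relation.Nullary using (¬_)
open import Relation.Nullary.Decidable using (_⊎-dec_)
open import Function.Definitions using (Injective)

record Multigraph : Set₁ where
  field
    V      : Set
    E      : Set
    ends   : E → V × V
    noLoop : ∀ e → proj₁ (ends e) ≢ proj₂ (ends e)

Joins : (G : Multigraph) → Multigraph.E G → Multigraph.V G → Multigraph.V G → Set
Joins G e x y =
  (proj₁ (ends e) ≡ x × proj₂ (ends e) ≡ y) ⊎ (proj₁ (ends e) ≡ y × proj₂ (ends e) ≡ x)
  where open Multigraph G

next : {k : ℕ} → Fin k → Fin k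
next {ℕ.suc k} i = Data.Nat.DivMod._mod_ (ℕ.suc (Data.Fin.toℕ i)) (ℕ.suc k)

-- A cycle of length k ≥ 2: distinct vertices v₀,…,v_{k-1} and distinct
-- edges e₀,…,e_{k-1}, where e_i joins v_i and v_{i+1 mod k}.
-- (For k = 2 this is a pair of parallel edges.)
record Cycle (G : Multigraph) : Set where
  open Multigraph G
  field
    len    : ℕ
    len≥2  : len ≥ 2
    vtx    : Fin len → V
    edg    : Fin len → E
    vtxInj : Injective _≡_ _≡_ vtx
    edgInj : Injective _≡_ _≡_ edg
    joins  : ∀ i → Joins G (edg i) (vtx i) (vtx (next i))

Acyclic : Multigraph → Set
Acyclic G = ¬ Cycle G

record Graph : Set where
  field
    n      : ℕ
    m      : ℕ
    ends   : Fin m → Fin n × Fin n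
    noLoop : ∀ e → proj₁ (ends e) ≢ proj₂ (ends e)

toMultigraph : Graph → Multigraph
toMultigraph G = record { V = Fin n ; E = Fin m ; ends = ends ; noLoop = noLoop }
  where open Graph G

Incident : (G : Graph) → Fin (Graph.n G) → Fin (Graph.m G) → Set
Incident G w e = proj₁ (ends e) ≡ w ⊎ proj₂ (ends e) ≡ w
  where open Graph G

deleteVertex : (G : Graph) → Fin (Graph.n G) → Multigraph
deleteVertex G v = record
  { V      = Σ (Fin n) (λ w → w ≢ v)
  ; E      = Σ (Fin m) (λ e → ¬ Incident G v e)
  ; ends   = ends'
  ; noLoop = noLoop'
  }
  where
  open Graph G
  ends' : Σ (Fin m) (λ e → ¬ Incident G v e) → Σ (Fin n) (λ w → w ≢ v) × Σ (Fin n) (λ w → w ≢ v)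
  ends' (e , ¬i) = (proj₁ (ends e) , λ eq → ¬i (Data.Sum.inj₁ eq))
                 , (proj₂ (ends e) , λ eq → ¬i (Data.Sum.inj₂ eq))
  noLoop' : ∀ e → proj₁ (ends' e) ≢ proj₂ (ends' e)
  noLoop' (e , ¬i) eq = noLoop e (Relation.Binary.PropositionalEquality.cong proj₁ eq)

-- The group Γ(G), given by the presentation
--   generators x_e (e ∈ E(G)),
--   x_e² = 1,
--   [x_e , x_e'] = 1 whenever e, e' ∈ E(w) for some vertex w,
--   ∏_{e ∈ E(w)} x_e = 1 for every vertex w
-- Elements are words in the free group on the x_e (letters (true , e) = x_e,
-- (false , e) = x_e⁻¹), modulo the congruence generated by free reduction
-- and the relators.

Letter : ℕ → Set
Letter m = Bool × Fin m

Word : ℕ → Set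
Word m = List (Letter m)

invL : {m : ℕ} → Letter m → Letter m
invL (b , e) = (not b , e)

x : {m : ℕ} → Fin m → Word m
x e = (true , e) ∷ []

x⁻¹ : {m : ℕ} → Fin m → Word m
x⁻¹ e = (false , e) ∷ []

incident? : (G : Graph) (w : Fin (Graph.n G)) (e : Fin (Graph.m G)) →
            Relation.Nullary.Dec (Incident G w e)
incident? G w e = (proj₁ (ends e) ≟F w) ⊎-dec (proj₂ (ends e) ≟F w)
  where open Graph G

-- the word ∏_{e ∈ E(w)} x_e  (edges in increasing order; the order is
-- immaterial in Γ(G) since these generators pairwise commute)
vertexProduct : (G : Graph) → Fin (Graph.n G) → Word (Graph.m G)
vertexProduct G w = Data.List.concatMap x (filter (incident? G w) (allFin (Graph.m G)))

data ΓEq (G : Graph) : Word (Graph.m G) → Word (Graph.m G) → Set where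
  ≈refl  : ∀ {u} → ΓEq G u u
  ≈sym   : ∀ {u w} → ΓEq G u w → ΓEq G w u
  ≈trans : ∀ {u w z} → ΓEq G u w → ΓEq G w z → ΓEq G u z
  ≈cong  : ∀ {u u' w w'} → ΓEq G u u' → ΓEq G w w' → ΓEq G (u ++ w) (u' ++ w')
  free   : ∀ l → ΓEq G (l ∷ invL l ∷ []) []
  square : ∀ e → ΓEq G (x e ++ x e) []
  commut : ∀ w e e' → Incident G w e → Incident G w e' →
           ΓEq G (x e ++ x e' ++ x⁻¹ e ++ x⁻¹ e') []
  vertex : ∀ w → ΓEq G (vertexProduct G w) []

ΓAbelian : Graph → Set
ΓAbelian G = ∀ (u w : Word (Graph.m G)) → ΓEq G (u ++ w) (w ++ u)

-- Fix an edge g.  The edges e with x_e commuting with x_g are closed under a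
-- rule: if at some vertex w every edge except f qualifies, so does f, since the
-- vertex relation at w writes x_f as a product of the other generators at w.
-- When G ∖ v is a forest every edge is reached from the edges at v by this rule:
-- a set of edges that is never reached avoids v and has no leaf, so a walk in it
-- that never backtracks closes a cycle of G ∖ v.  Taking g at v, the generators
-- at v commute with each other and hence with everything; taking g arbitrary,
-- x_g then commutes with the generators at v and hence with everything.
module Submission where

open import Defs
open import Data.Nat using (ℕ; zero; suc; _+_; _∸_; _<_; z≤n; s≤s)
open import Data.Nat.Properties
  using (<-irrefl; <-trans; <-cmp; ≤-<-trans; <-≤-trans; ≤-reflexive; ≤-pred; n<1+n;
         m≤n⇒m<n∨m≡n; +-cancelʳ-≡; +-monoˡ-<; m∸n+n≡m; <⇒≤; ∸-monoʳ-<; m<n⇒0<n∸m)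
open import Data.Nat.DivMod using (_%_; m<n⇒m%n≡m; n%n≡0)
open import Data.Nat.Induction using (<-wellFounded)
open import Induction.WellFounded using (Acc; acc)
open import Data.Fin using (Fin; toℕ; fromℕ<; _≟_)
open import Data.Fin.Properties
  using (toℕ-injective; toℕ<n; toℕ-fromℕ<; pigeonhole; any?; all?; ¬∀⟶∃¬)
open import Data.Fin.Subset using (Subset; _∈_; _∉_; ⁅_⁆; _∪_; ∣_∣) renaming (⊥ to ∅)
open import Data.Fin.Subset.Properties
  using (_∈?_; ∉⊥; x∈⁅x⁆; x∈⁅y⁆⇒x≡y; p⊆p∪q; x∈p∪q⁺; x∈p∪q⁻; ∣p∣≤n; p⊂q⇒∣p∣<∣q∣)
open import Data.Bool using (true; false)
open import Data.List using ([]; _∷_; _++_; filter; allFin; concatMap)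
open import Data.List.Properties using (++-assoc; ++-identityʳ)
open import Data.List.Membership.Propositional using () renaming (_∈_ to _∈ˡ_)
open import Data.List.Membership.Propositional.Properties using (∈-filter⁺; ∈-filter⁻; ∈-allFin)
open import Data.List.Relation.Unary.Any using (here; there)
open import Data.List.Relation.Unary.All using () renaming (lookup to All-lookup)
open import Data.List.Relation.Unary.AllPairs using (_∷_)
open import Data.List.Relation.Unary.Unique.Propositional using (Unique)
open import Data.List.Relation.Unary.Unique.Propositional.Properties using (allFin⁺; filter⁺)
open import Data.Product using (Σ; ∃-syntax; _×_; _,_; proj₁; proj₂)
open import Data.Sum using (_⊎_; inj₁; inj₂; [_,_])
open import Data.Empty using (⊥-elim)
open import Level using (0ℓ)
open import Relation.Binary.Bundles using (Setoid)
open import Relation.Binary.Definitions using (tri<; tri≈; tri>)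
open import Relation.Binary.PropositionalEquality
  using (_≡_; _≢_; refl; sym; trans; cong; subst)
open import Relation.Nullary using (¬_; Dec; yes; no)
open import Relation.Nullary.Decidable using (¬?; _×-dec_; _⊎-dec_; _→-dec_; decidable-stable)

-- Commutation in Γ(G)

module _ (G : Graph) where
  open Graph G

  infix 4 _≈_
  _≈_ : Word m → Word m → Set
  _≈_ = ΓEq G

  Γ-setoid : Setoid 0ℓ 0ℓ
  Γ-setoid = record
    { Carrier       = Word m
    ; _≈_           = _≈_
    ; isEquivalence = record { refl = ≈refl ; sym = ≈sym ; trans = ≈trans }
    }

  open import Relation.Binary.Reasoning.Setoid Γ-setoid

  ≡⇒≈ : ∀ {u w} → u ≡ w → u ≈ w
  ≡⇒≈ refl = ≈refl

  ++-congˡ : ∀ c {u w} → u ≈ w → c ++ u ≈ c ++ w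
  ++-congˡ c = ≈cong ≈refl

  ++-congʳ : ∀ c {u w} → u ≈ w → u ++ c ≈ w ++ c
  ++-congʳ c u≈w = ≈cong u≈w ≈refl

  inverse : Word m → Word m
  inverse []      = []
  inverse (l ∷ u) = inverse u ++ invL l ∷ []

  free⁻¹ : ∀ l → invL l ∷ l ∷ [] ≈ []
  free⁻¹ (true  , e) = free (false , e)
  free⁻¹ (false , e) = free (true  , e)

  inverseʳ : ∀ u → u ++ inverse u ≈ []
  inverseʳ []      = ≈refl
  inverseʳ (l ∷ u) = begin
    l ∷ u ++ inverse u ++ invL l ∷ []           ≡⟨ cong (l ∷_) (++-assoc u (inverse u) _) ⟨
    (l ∷ []) ++ (u ++ inverse u) ++ invL l ∷ [] ≈⟨ ++-congˡ (l ∷ []) (++-congʳ (invL l ∷ []) (inverseʳ u)) ⟩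
    l ∷ invL l ∷ []                             ≈⟨ free l ⟩
    []                                          ∎

  inverseˡ : ∀ u → inverse u ++ u ≈ []
  inverseˡ []      = ≈refl
  inverseˡ (l ∷ u) = begin
    (inverse u ++ invL l ∷ []) ++ l ∷ u ≡⟨ ++-assoc (inverse u) _ _ ⟩
    inverse u ++ (invL l ∷ l ∷ []) ++ u ≈⟨ ++-congˡ (inverse u) (++-congʳ u (free⁻¹ l)) ⟩
    inverse u ++ u                      ≈⟨ inverseˡ u ⟩
    []                                  ∎

  ≈-from-inverse : ∀ c d → c ++ inverse d ≈ [] → c ≈ d
  ≈-from-inverse c d c/d≈[] = begin
    c                     ≡⟨ ++-identityʳ c ⟨
    c ++ []               ≈⟨ ++-congˡ c (≈sym (inverseˡ d)) ⟩
    c ++ inverse d ++ d   ≡⟨ ++-assoc c _ _ ⟨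
    (c ++ inverse d) ++ d ≈⟨ ++-congʳ d c/d≈[] ⟩
    d                     ∎

  ≈-middle : ∀ a c b → c ≈ inverse a ++ (a ++ c ++ b) ++ inverse b
  ≈-middle a c b = begin
    c                                       ≡⟨ ++-identityʳ c ⟨
    [] ++ c ++ []                           ≈⟨ ≈cong (≈sym (inverseˡ a)) (++-congˡ c (≈sym (inverseʳ b))) ⟩
    (inverse a ++ a) ++ c ++ b ++ inverse b ≡⟨ ++-assoc (inverse a) a _ ⟩
    inverse a ++ a ++ c ++ b ++ inverse b   ≡⟨ cong (λ w → inverse a ++ a ++ w) (++-assoc c b _) ⟨
    inverse a ++ a ++ (c ++ b) ++ inverse b ≡⟨ cong (inverse a ++_) (++-assoc a _ _) ⟨
    inverse a ++ (a ++ c ++ b) ++ inverse b ∎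

  x⁻¹≈x : ∀ e → x⁻¹ e ≈ x e
  x⁻¹≈x e = begin
    x⁻¹ e                 ≡⟨ ++-identityʳ _ ⟨
    x⁻¹ e ++ []           ≈⟨ ++-congˡ (x⁻¹ e) (≈sym (square e)) ⟩
    (x⁻¹ e ++ x e) ++ x e ≈⟨ ++-congʳ (x e) (free (false , e)) ⟩
    x e                   ∎

  Commute : Word m → Word m → Set
  Commute h u = u ++ h ≈ h ++ u

  commute-[] : ∀ h → Commute h []
  commute-[] h = ≡⇒≈ (sym (++-identityʳ h))

  commute-++ : ∀ {h a b} → Commute h a → Commute h b → Commute h (a ++ b)
  commute-++ {h} {a} {b} ha hb = begin
    (a ++ b) ++ h ≡⟨ ++-assoc a b h ⟩
    a ++ b ++ h   ≈⟨ ++-congˡ a hb ⟩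
    a ++ h ++ b   ≡⟨ ++-assoc a h b ⟨
    (a ++ h) ++ b ≈⟨ ++-congʳ b ha ⟩
    (h ++ a) ++ b ≡⟨ ++-assoc h a b ⟩
    h ++ a ++ b   ∎

  commute-resp : ∀ {h u w} → u ≈ w → Commute h u → Commute h w
  commute-resp {h} {u} {w} u≈w hu = begin
    w ++ h ≈⟨ ++-congʳ h u≈w ⟨
    u ++ h ≈⟨ hu ⟩
    h ++ u ≈⟨ ++-congˡ h u≈w ⟩
    h ++ w ∎

  commute-inverse : ∀ {h u} → Commute h u → Commute h (inverse u)
  commute-inverse {h} {u} hu = begin
    inverse u ++ h                       ≈⟨ ≈-middle [] (inverse u ++ h) u ⟩
    ((inverse u ++ h) ++ u) ++ inverse u ≡⟨ cong (_++ inverse u) (++-assoc (inverse u) h u) ⟩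
    (inverse u ++ h ++ u) ++ inverse u   ≈⟨ ++-congʳ (inverse u) (++-congˡ (inverse u) hu) ⟨
    (inverse u ++ u ++ h) ++ inverse u   ≡⟨ cong (_++ inverse u) (++-assoc (inverse u) u h) ⟨
    ((inverse u ++ u) ++ h) ++ inverse u ≈⟨ ++-congʳ (inverse u) (++-congʳ h (inverseˡ u)) ⟩
    h ++ inverse u                       ∎

  commute-middle : ∀ {h a b} c → Commute h a → Commute h b → Commute h (a ++ c ++ b) → Commute h c
  commute-middle {a = a} {b} c ha hb habc =
    commute-resp (≈sym (≈-middle a c b))
      (commute-++ {a = inverse a} (commute-inverse {u = a} ha)
        (commute-++ {a = a ++ c ++ b} habc (commute-inverse {u = b} hb)))

  commute-concatMap : ∀ {h} L → (∀ g → g ∈ˡ L → Commute h (x g)) → Commute h (concatMap x L)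
  commute-concatMap {h} []      _   = commute-[] h
  commute-concatMap     (g ∷ L) hL  =
    commute-++ {a = x g} (hL g (here refl)) (commute-concatMap L (λ g′ g′∈L → hL g′ (there g′∈L)))

  -- Generalised over a prefix a, so that the induction can move factors before f into a.
  commute-factor : ∀ {h} a L f → Unique L → f ∈ˡ L → (∀ g → g ∈ˡ L → g ≢ f → Commute h (x g)) →
                   Commute h a → Commute h (a ++ concatMap x L) → Commute h (x f)
  commute-factor a (g ∷ L) f (g∉L ∷ _) (here refl) others ha hprod =
    commute-middle {a = a} {b = concatMap x L} (x f) ha
      (commute-concatMap L (λ g′ g′∈L → others g′ (there g′∈L) (λ g′≡g → All-lookup g∉L g′∈L (sym g′≡g))))
      hprod
  commute-factor a (g ∷ L) f (g∉L ∷ unique) (there f∈L) others ha hprod =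
    commute-factor (a ++ x g) L f unique f∈L (λ g′ g′∈L → others g′ (there g′∈L))
      (commute-++ {a = a} ha (others g (here refl) (All-lookup g∉L f∈L)))
      (subst (Commute _) (sym (++-assoc a (x g) _)) hprod)

  commute-vertex-rule : ∀ {h w f} → Incident G w f →
                        (∀ g → Incident G w g → g ≢ f → Commute h (x g)) → Commute h (x f)
  commute-vertex-rule {h} {w} {f} w∈f others =
    commute-factor [] (filter (incident? G w) (allFin m)) f
      (filter⁺ (incident? G w) (allFin⁺ m))
      (∈-filter⁺ (incident? G w) (∈-allFin f) w∈f)
      (λ g g∈E[w] → others g (proj₂ (∈-filter⁻ (incident? G w) {xs = allFin m} g∈E[w])))
      (commute-[] h)
      (commute-resp (≈sym (vertex w)) (commute-[] h))

  commute-incident : ∀ {w e g} → Incident G w e → Incident G w g → Commute (x g) (x e)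
  commute-incident {w} {e} {g} w∈e w∈g = ≈-from-inverse (x e ++ x g) (x g ++ x e) (commut w e g w∈e w∈g)

  commute-word : ∀ h → (∀ e → Commute h (x e)) → ∀ u → Commute h u
  commute-word h _  []            = commute-[] h
  commute-word h hx ((true  , e) ∷ u) = commute-++ {a = x e} (hx e) (commute-word h hx u)
  commute-word h hx ((false , e) ∷ u) =
    commute-++ {a = x⁻¹ e} (commute-resp (≈sym (x⁻¹≈x e)) (hx e)) (commute-word h hx u)

  abelian-if-generators-commute : (∀ e g → Commute (x e) (x g)) → ΓAbelian G
  abelian-if-generators-commute hx u w =
    commute-word w (λ e → ≈sym (commute-word (x e) (hx e) w)) u

-- Cycles from non-backtracking walks

record NonBacktrackingWalk (G : Graph) : Set where
  open Graph G
  field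
    vertexAt          : ℕ → Fin n
    edgeAt            : ℕ → Fin m
    joins-consecutive : ∀ k → Joins (toMultigraph G) (edgeAt k) (vertexAt k) (vertexAt (suc k))
    non-backtracking  : ∀ k → edgeAt (suc k) ≢ edgeAt k

toℕ-next-< : ∀ {L} (t : Fin (suc L)) → suc (toℕ t) < suc L → toℕ (next t) ≡ suc (toℕ t)
toℕ-next-< t t+1<L = trans (toℕ-fromℕ< _) (m<n⇒m%n≡m t+1<L)

toℕ-next-last : ∀ {L} (t : Fin (suc L)) → suc (toℕ t) ≡ suc L → toℕ (next t) ≡ 0
toℕ-next-last {L} t t+1≡L = trans (toℕ-fromℕ< _) (trans (cong (_% suc L) t+1≡L) (n%n≡0 (suc L)))

module _ {n : ℕ} (u : ℕ → Fin n) where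

  InjectiveBelow : ℕ → Set
  InjectiveBelow j = ∀ a b → a < j → b < j → u a ≡ u b → a ≡ b

  FirstRepetition : Set
  FirstRepetition = Σ ℕ λ i → Σ ℕ λ j → i < j × u i ≡ u j × InjectiveBelow j

  injectiveBelow-or-firstRepetition : ∀ j → InjectiveBelow j ⊎ FirstRepetition
  injectiveBelow-or-firstRepetition zero = inj₁ λ _ _ ()
  injectiveBelow-or-firstRepetition (suc j) with injectiveBelow-or-firstRepetition j
  ... | inj₂ repetition = inj₂ repetition
  ... | inj₁ injective with any? (λ (i : Fin j) → u (toℕ i) ≟ u j)
  ...   | yes (i , uᵢ≡uⱼ) = inj₂ (toℕ i , j , toℕ<n i , uᵢ≡uⱼ , injective)
  ...   | no  new          = inj₁ extend
    where
    new′ : ∀ a → a < j → u a ≢ u j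
    new′ a a<j uₐ≡uⱼ = new (fromℕ< a<j , subst (λ c → u c ≡ u j) (sym (toℕ-fromℕ< a<j)) uₐ≡uⱼ)

    extend : InjectiveBelow (suc j)
    extend a b a<j+1 b<j+1 uₐ≡u_b with m≤n⇒m<n∨m≡n (≤-pred a<j+1) | m≤n⇒m<n∨m≡n (≤-pred b<j+1)
    ... | inj₁ a<j  | inj₁ b<j  = injective a b a<j b<j uₐ≡u_b
    ... | inj₁ a<j  | inj₂ refl = ⊥-elim (new′ a a<j uₐ≡u_b)
    ... | inj₂ refl | inj₁ b<j  = ⊥-elim (new′ b b<j (sym uₐ≡u_b))
    ... | inj₂ refl | inj₂ refl = refl

  first-repetition : FirstRepetition
  first-repetition with injectiveBelow-or-firstRepetition (suc n)
  ... | inj₂ repetition = repetition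
  ... | inj₁ injective with pigeonhole (n<1+n n) (λ (i : Fin (suc n)) → u (toℕ i))
  ...   | i , j , i<j , uᵢ≡uⱼ = ⊥-elim (<-irrefl (injective _ _ (toℕ<n i) (toℕ<n j) uᵢ≡uⱼ) i<j)

module _ (G : Graph) where
  open Graph G

  joins⇒incidentˡ : ∀ {e a b} → Joins (toMultigraph G) e a b → Incident G a e
  joins⇒incidentˡ (inj₁ (p₁≡a , _)) = inj₁ p₁≡a
  joins⇒incidentˡ (inj₂ (_ , p₂≡a)) = inj₂ p₂≡a

  joins⇒incidentʳ : ∀ {e a b} → Joins (toMultigraph G) e a b → Incident G b e
  joins⇒incidentʳ (inj₁ (_ , p₂≡b)) = inj₂ p₂≡b
  joins⇒incidentʳ (inj₂ (p₁≡b , _)) = inj₁ p₁≡b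

  joins-shared-endpoint : ∀ {e a b c d} → Joins (toMultigraph G) e a b → Joins (toMultigraph G) e c d →
                          a ≡ c ⊎ b ≡ c
  joins-shared-endpoint (inj₁ (p₁≡a , _)) (inj₁ (p₁≡c , _)) = inj₁ (trans (sym p₁≡a) p₁≡c)
  joins-shared-endpoint (inj₁ (_ , p₂≡b)) (inj₂ (_ , p₂≡c)) = inj₂ (trans (sym p₂≡b) p₂≡c)
  joins-shared-endpoint (inj₂ (p₁≡b , _)) (inj₁ (p₁≡c , _)) = inj₂ (trans (sym p₁≡b) p₁≡c)
  joins-shared-endpoint (inj₂ (_ , p₂≡a)) (inj₂ (_ , p₂≡c)) = inj₁ (trans (sym p₂≡a) p₂≡c)

  opposite : Fin m → Fin n → Fin n
  opposite e w with proj₁ (ends e) ≟ w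
  ... | yes _ = proj₂ (ends e)
  ... | no  _ = proj₁ (ends e)

  opposite-joins : ∀ {w e} → Incident G w e → Joins (toMultigraph G) e w (opposite e w)
  opposite-joins {w} {e} w∈e with proj₁ (ends e) ≟ w
  ... | yes p₁≡w = inj₁ (p₁≡w , refl)
  opposite-joins (inj₁ p₁≡w) | no p₁≢w = ⊥-elim (p₁≢w p₁≡w)
  opposite-joins (inj₂ p₂≡w) | no _    = inj₂ (refl , p₂≡w)

  drop : NonBacktrackingWalk G → ℕ → NonBacktrackingWalk G
  drop W i = record
    { vertexAt          = λ k → vertexAt (k + i)
    ; edgeAt            = λ k → edgeAt (k + i)
    ; joins-consecutive = λ k → joins-consecutive (k + i)
    ; non-backtracking  = λ k → non-backtracking (k + i)
    }
    where open NonBacktrackingWalk W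

  module _ (W : NonBacktrackingWalk G) where
    open NonBacktrackingWalk W

    closedWalk⇒cycle : ∀ L → 0 < L → vertexAt 0 ≡ vertexAt L → InjectiveBelow vertexAt L →
                             Σ (Cycle (toMultigraph G)) λ C → ∀ t → ∃[ k ] Cycle.edg C t ≡ edgeAt k
    closedWalk⇒cycle 1 _ closed _ = ⊥-elim (noLoop (edgeAt 0) (joins-loop closing-edge))
      where
      closing-edge : Joins (toMultigraph G) (edgeAt 0) (vertexAt 0) (vertexAt 0)
      closing-edge = subst (Joins (toMultigraph G) (edgeAt 0) (vertexAt 0)) (sym closed) (joins-consecutive 0)
      joins-loop : ∀ {e a} → Joins (toMultigraph G) e a a → proj₁ (ends e) ≡ proj₂ (ends e)
      joins-loop (inj₁ (p₁≡a , p₂≡a)) = trans p₁≡a (sym p₂≡a)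
      joins-loop (inj₂ (p₁≡a , p₂≡a)) = trans p₁≡a (sym p₂≡a)
    closedWalk⇒cycle L@(suc (suc _)) _ closed distinct = cycle , λ t → toℕ t , refl
      where
      -- Equal edges share an endpoint: v_p = v_q contradicts injectivity, and
      -- v_(p+1) = v_q forces q = p + 1, contradicting non-backtracking.
      edges-distinct : ∀ {p q} → p < q → q < L → edgeAt p ≢ edgeAt q
      edges-distinct {p} {q} p<q q<L eₚ≡e_q =
        [ (λ vₚ≡v_q → <-irrefl (distinct p q (<-trans p<q q<L) q<L vₚ≡v_q) p<q)
        , (λ vₚ₊₁≡v_q → non-backtracking p
            (trans (cong edgeAt (distinct _ q (≤-<-trans p<q q<L) q<L vₚ₊₁≡v_q)) (sym eₚ≡e_q)))
        ] (joins-shared-endpoint step-p (joins-consecutive q))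
        where
        step-p : Joins (toMultigraph G) (edgeAt q) (vertexAt p) (vertexAt (suc p))
        step-p = subst (λ e → Joins (toMultigraph G) e (vertexAt p) (vertexAt (suc p)))
                       eₚ≡e_q (joins-consecutive p)

      wrap-around : ∀ (t : Fin L) → vertexAt (suc (toℕ t)) ≡ vertexAt (toℕ (next t))
      wrap-around t with m≤n⇒m<n∨m≡n (toℕ<n t)
      ... | inj₁ t+1<L = cong vertexAt (sym (toℕ-next-< t t+1<L))
      ... | inj₂ t+1≡L =
        trans (cong vertexAt t+1≡L) (trans (sym closed) (cong vertexAt (sym (toℕ-next-last t t+1≡L))))

      edgInj : ∀ {s t : Fin L} → edgeAt (toℕ s) ≡ edgeAt (toℕ t) → s ≡ t
      edgInj {s} {t} eₛ≡eₜ with <-cmp (toℕ s) (toℕ t)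
      ... | tri< s<t _ _ = ⊥-elim (edges-distinct s<t (toℕ<n t) eₛ≡eₜ)
      ... | tri≈ _ s≡t _ = toℕ-injective s≡t
      ... | tri> _ _ t<s = ⊥-elim (edges-distinct t<s (toℕ<n s) (sym eₛ≡eₜ))

      cycle : Cycle (toMultigraph G)
      cycle = record
        { len    = L
        ; len≥2  = s≤s (s≤s z≤n)
        ; vtx    = λ t → vertexAt (toℕ t)
        ; edg    = λ t → edgeAt (toℕ t)
        ; vtxInj = λ {s} {t} vₛ≡vₜ → toℕ-injective (distinct _ _ (toℕ<n s) (toℕ<n t) vₛ≡vₜ)
        ; edgInj = edgInj
        ; joins  = λ t → subst (Joins (toMultigraph G) (edgeAt (toℕ t)) (vertexAt (toℕ t)))
                               (wrap-around t) (joins-consecutive (toℕ t))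
        }

  repetition⇒cycle : (W : NonBacktrackingWalk G) → let open NonBacktrackingWalk W in
    ∀ {i j} → i < j → vertexAt i ≡ vertexAt j → InjectiveBelow vertexAt j →
    Σ (Cycle (toMultigraph G)) λ C → ∀ t → ∃[ k ] Cycle.edg C t ≡ edgeAt k
  repetition⇒cycle W {i} {j} i<j vᵢ≡vⱼ distinct =
    let C , edges = closedWalk⇒cycle (drop W i) (j ∸ i) (m<n⇒0<n∸m i<j) closed distinct′
    in C , λ t → let k , eₜ≡eₖ₊ᵢ = edges t in k + i , eₜ≡eₖ₊ᵢ
    where
    open NonBacktrackingWalk W
    j∸i+i≡j : j ∸ i + i ≡ j
    j∸i+i≡j = m∸n+n≡m (<⇒≤ i<j)
    closed : vertexAt i ≡ vertexAt (j ∸ i + i)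
    closed = trans vᵢ≡vⱼ (cong vertexAt (sym j∸i+i≡j))
    shift : ∀ {a} → a < j ∸ i → a + i < j
    shift a<j∸i = <-≤-trans (+-monoˡ-< i a<j∸i) (≤-reflexive j∸i+i≡j)
    distinct′ : InjectiveBelow (λ k → vertexAt (k + i)) (j ∸ i)
    distinct′ a b a<j∸i b<j∸i vₐ≡v_b = +-cancelʳ-≡ i a b (distinct _ _ (shift a<j∸i) (shift b<j∸i) vₐ≡v_b)

  nonBacktrackingWalk⇒cycle : (W : NonBacktrackingWalk G) →
               Σ (Cycle (toMultigraph G)) λ C → ∀ t → ∃[ k ] Cycle.edg C t ≡ NonBacktrackingWalk.edgeAt W k
  nonBacktrackingWalk⇒cycle W =
    let i , j , i<j , vᵢ≡vⱼ , distinct = first-repetition (NonBacktrackingWalk.vertexAt W)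
    in repetition⇒cycle W i<j vᵢ≡vⱼ distinct

module _ (G : Graph) (F : Fin (Graph.m G) → Set)
  (no-leaf : ∀ w e → F e → Incident G w e → Σ (Fin (Graph.m G)) λ g → Incident G w g × g ≢ e × F g)
  where
  open Graph G

  record Arrival : Set where
    field
      at       : Fin n
      via      : Fin m
      via∈F  : F via
      at∈via   : Incident G at via
  open Arrival

  departure : (s : Arrival) → Σ (Fin m) λ g → Incident G (at s) g × g ≢ via s × F g
  departure s = no-leaf (at s) (via s) (via∈F s) (at∈via s)

  depart : Arrival → Arrival
  depart s =
    let g , at∈g , _ , g∈F = departure s
    in record { at = opposite G g (at s) ; via = g ; via∈F = g∈F
              ; at∈via = joins⇒incidentʳ G (opposite-joins G at∈g) }

  arrivals : Arrival → ℕ → Arrival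
  arrivals s zero    = s
  arrivals s (suc k) = depart (arrivals s k)

  walk-in : Arrival → NonBacktrackingWalk G
  walk-in s = record
    { vertexAt          = λ k → at (arrivals s k)
    ; edgeAt            = λ k → via (arrivals s (suc k))
    ; joins-consecutive = λ k → opposite-joins G (proj₁ (proj₂ (departure (arrivals s k))))
    ; non-backtracking  = λ k → proj₁ (proj₂ (proj₂ (departure (arrivals s (suc k)))))
    }

  no-leaf⇒cycle : ∀ e → F e → Σ (Cycle (toMultigraph G)) λ C → ∀ t → F (Cycle.edg C t)
  no-leaf⇒cycle e e∈F =
    let C , edges = nonBacktrackingWalk⇒cycle G (walk-in start)
    in C , λ t → let k , eₜ≡eₖ = edges t in subst F (sym eₜ≡eₖ) (via∈F (arrivals start (suc k)))
    where
    start : Arrival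
    start = record { at = proj₂ (ends e) ; via = e ; via∈F = e∈F ; at∈via = inj₂ refl }

-- Lifting cycles to G ∖ v

module _ (G : Graph) (v : Fin (Graph.n G)) where
  open Graph G

  -- Without function extensionality two proofs of w ≢ v need not be equal, so
  -- lifted vertices carry the proof recomputed from w ≟ v, which is unique.
  avoiding : (w : Fin n) → w ≢ v → w ≢ v
  avoiding w w≢v with w ≟ v
  ... | yes _    = w≢v
  ... | no  w≢v′ = w≢v′

  avoiding-irrelevant : ∀ w (p q : w ≢ v) → avoiding w p ≡ avoiding w q
  avoiding-irrelevant w p q with w ≟ v
  ... | yes w≡v = ⊥-elim (p w≡v)
  ... | no  _   = refl

  liftVertex : (w : Fin n) → w ≢ v → Multigraph.V (deleteVertex G v)
  liftVertex w w≢v = w , avoiding w w≢v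

  liftVertex-cong : ∀ {w w′} → w ≡ w′ → (p : w ≢ v) (q : w′ ≢ v) → liftVertex w p ≡ liftVertex w′ q
  liftVertex-cong {w} refl p q = cong (w ,_) (avoiding-irrelevant w p q)

  end₁≢v : ∀ {e} → ¬ Incident G v e → proj₁ (ends e) ≢ v
  end₁≢v v∉e p₁≡v = v∉e (inj₁ p₁≡v)

  end₂≢v : ∀ {e} → ¬ Incident G v e → proj₂ (ends e) ≢ v
  end₂≢v v∉e p₂≡v = v∉e (inj₂ p₂≡v)

  liftEdge : (e : Fin m) → ¬ Incident G v e → Multigraph.E (deleteVertex G v)
  liftEdge e v∉e = e , [ avoiding (proj₁ (ends e)) (end₁≢v v∉e) , avoiding (proj₂ (ends e)) (end₂≢v v∉e) ]

  liftEdge-joins : ∀ {e a b} (v∉e : ¬ Incident G v e) (a≢v : a ≢ v) (b≢v : b ≢ v) →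
                   Joins (toMultigraph G) e a b →
                   Joins (deleteVertex G v) (liftEdge e v∉e) (liftVertex a a≢v) (liftVertex b b≢v)
  liftEdge-joins v∉e a≢v b≢v (inj₁ (p₁≡a , p₂≡b)) =
    inj₁ (liftVertex-cong p₁≡a (end₁≢v v∉e) a≢v , liftVertex-cong p₂≡b (end₂≢v v∉e) b≢v)
  liftEdge-joins v∉e a≢v b≢v (inj₂ (p₁≡b , p₂≡a)) =
    inj₂ (liftVertex-cong p₁≡b (end₁≢v v∉e) b≢v , liftVertex-cong p₂≡a (end₂≢v v∉e) a≢v)

  liftCycle : (C : Cycle (toMultigraph G)) → (∀ t → ¬ Incident G v (Cycle.edg C t)) →
              Cycle (deleteVertex G v)
  liftCycle C avoids = record
    { len    = len
    ; len≥2  = len≥2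
    ; vtx    = λ t → liftVertex (vtx t) (vtx≢v t)
    ; edg    = λ t → liftEdge (edg t) (avoids t)
    ; vtxInj = λ vₛ≡vₜ → vtxInj (cong proj₁ vₛ≡vₜ)
    ; edgInj = λ eₛ≡eₜ → edgInj (cong proj₁ eₛ≡eₜ)
    ; joins  = λ t → liftEdge-joins (avoids t) (vtx≢v t) (vtx≢v (next t)) (joins t)
    }
    where
    open Cycle C
    vtx≢v : ∀ t → vtx t ≢ v
    vtx≢v t vₜ≡v = avoids t (subst (λ w → Incident G w (edg t)) vₜ≡v (joins⇒incidentˡ G (joins t)))

-- Induction over the edges when G ∖ v is acyclic

module _ (G : Graph) (v : Fin (Graph.n G)) (acyclic : Acyclic (deleteVertex G v)) where
  open Graph G

  Settled : Subset m → Fin n → Fin m → Set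
  Settled S w f = ∀ g → Incident G w g → g ≢ f → g ∈ S

  settled-by? : ∀ S w f g → Dec (Incident G w g → g ≢ f → g ∈ S)
  settled-by? S w f g = incident? G w g →-dec (¬? (g ≟ f) →-dec (g ∈? S))

  settled? : ∀ S w f → Dec (Settled S w f)
  settled? S w f = all? (settled-by? S w f)

  Forced : Subset m → Fin m → Set
  Forced S f = Incident G v f ⊎ Σ (Fin n) λ w → Incident G w f × Settled S w f

  forced? : ∀ S f → Dec (Forced S f)
  forced? S f = incident? G v f ⊎-dec any? λ w → incident? G w f ×-dec settled? S w f

  unsettled-neighbour : ∀ S {w f} → ¬ Settled S w f → Σ (Fin m) λ g → Incident G w g × g ≢ f × g ∉ S
  unsettled-neighbour S {w} {f} ¬settled =
    let g , ¬settled-g = ¬∀⟶∃¬ m _ (settled-by? S w f) ¬settled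
    in g , decidable-stable (incident? G w g) (λ w∉g → ¬settled-g λ w∈g → ⊥-elim (w∉g w∈g))
         , (λ g≡f → ¬settled-g λ _ g≢f → ⊥-elim (g≢f g≡f))
         , (λ g∈S → ¬settled-g λ _ _ → g∈S)

  -- Unforced edges outside S avoid v and have no leaf, so they carry a cycle of G ∖ v.
  unforced⇒complete : ∀ S → (∀ f → f ∉ S → ¬ Forced S f) → ∀ f → f ∈ S
  unforced⇒complete S unforced f = decidable-stable (f ∈? S) λ f∉S →
    let C , outside = no-leaf⇒cycle G (_∉ S) no-leaf f f∉S
    in acyclic (liftCycle G v C (λ t v∈eₜ → unforced _ (outside t) (inj₁ v∈eₜ)))
    where
    no-leaf : ∀ w e → e ∉ S → Incident G w e → Σ (Fin m) λ g → Incident G w g × g ≢ e × g ∉ S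
    no-leaf w e e∉S w∈e = unsettled-neighbour S λ settled → unforced e e∉S (inj₂ (w , w∈e , settled))

  edge-induction : (P : Fin m → Set) → (∀ e → Incident G v e → P e) →
                   (∀ w f → Incident G w f → (∀ g → Incident G w g → g ≢ f → P g) → P f) →
                   ∀ e → P e
  edge-induction P at-v rule = grow ∅ (<-wellFounded _) (λ e e∈∅ → ⊥-elim (∉⊥ e∈∅))
    where
    grow : ∀ S → Acc _<_ (m ∸ ∣ S ∣) → (∀ e → e ∈ S → P e) → ∀ e → P e
    grow S (acc smaller) P-S with any? (λ f → ¬? (f ∈? S) ×-dec forced? S f)
    ... | no none = λ e → P-S e (unforced⇒complete S (λ f f∉S forced → none (f , f∉S , forced)) e)
    ... | yes (f , f∉S , forced) = grow (S ∪ ⁅ f ⁆) (smaller shrinks) P-S∪f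
      where
      shrinks : m ∸ ∣ S ∪ ⁅ f ⁆ ∣ < m ∸ ∣ S ∣
      shrinks = ∸-monoʳ-< (p⊂q⇒∣p∣<∣q∣ (p⊆p∪q ⁅ f ⁆ , f , x∈p∪q⁺ (inj₂ (x∈⁅x⁆ f)) , f∉S)) (∣p∣≤n (S ∪ ⁅ f ⁆))
      P-f : P f
      P-f = [ at-v f , (λ (w , w∈f , settled) → rule w f w∈f λ g w∈g g≢f → P-S g (settled g w∈g g≢f)) ] forced
      P-S∪f : ∀ e → e ∈ S ∪ ⁅ f ⁆ → P e
      P-S∪f e e∈S∪f = [ P-S e , (λ e∈f → subst P (sym (x∈⁅y⁆⇒x≡y f e∈f)) P-f) ] (x∈p∪q⁻ S ⁅ f ⁆ e∈S∪f)

proposition5p9 : (G : Graph) →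
    Σ (Fin (Graph.n G)) (λ v → Acyclic (deleteVertex G v)) →
    ΓAbelian G
proposition5p9 G (v , acyclic) = abelian-if-generators-commute G commute-all
  where
  spread : ∀ h → (∀ e → Incident G v e → Commute G h (x e)) → ∀ e → Commute G h (x e)
  spread h at-v = edge-induction G v acyclic (λ e → Commute G h (x e)) at-v
                    (λ _ _ w∈f others → commute-vertex-rule G w∈f others)

  central-at-v : ∀ g → Incident G v g → ∀ e → Commute G (x g) (x e)
  central-at-v g v∈g = spread (x g) (λ e v∈e → commute-incident G v∈e v∈g)

  commute-all : ∀ g e → Commute G (x g) (x e)
  commute-all g = spread (x g) (λ e v∈e → ≈sym (central-at-v e v∈e g))
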